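{- Let $q$ be a prime, let $P$ be a poset of height $2$ on $m$ elements, and suppose $q\nmid e(P)$. Then $P$ has a linear extension $\ell$ which is adapted, i.e. for every $i$ with $1\le i\le\lfloor m/q\rfloor$, the induced subposet of $P$ on the elements with labels $(i-1)q+1,(i-1)q+2,\dots,iq$ under $\ell$ is connected.
   Context: A poset has height $2$ if every chain has at most two elements. A linear extension of a poset $P=(X,\prec)$ with $|X|=m$ is a bijection $\ell:X\to[m]$ with $\ell(x)<\ell(y)$ whenever $x\prec y$; $e(P)$ is their number; $\ell$ assigns label $\ell(x)$ to $x$. A poset is connected if its Hasse diagram is connected. -}

module Defs where

open import Data.Nat using (ℕ; zero; suc; _*_; _∸_; _≤_; _<_; _<?_)
open import Data.Fin using (Fin; toℕ)
open import Data.Fin.Properties using (all?; any?) renaming (_≟_ to _≟ᶠ_)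
open import Data.Vec using (Vec; []; _∷_; lookup)
open import Data.List using (List; [_]; map; concatMap; filter; length; allFin)
open import Data.Product using (Σ; ∃; _×_; _,_)
open import Data.Sum using (_⊎_)
open import Data.Empty using (⊥)
open import Relation.Nullary using (¬_; Dec; _×-dec_; _→-dec_)
open import Relation.Binary using (Rel; Decidable)
open import Relation.Binary.PropositionalEquality using (_≡_)

-- The order relation is
-- required to be decidable (always true classically for a finite set; it is
-- needed to define the number of linear extensions as a count).
record FinPoset (m : ℕ) : Set₁ where
  field
    _≺_     : Rel (Fin m) _
    _≺?_    : Decidable _≺_
    irrefl  : ∀ x → ¬ (x ≺ x)
    transit : ∀ {x y z} → x ≺ y → y ≺ z → x ≺ z

open FinPoset public

HasHeight2 : ∀ {m} → FinPoset m → Set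
HasHeight2 P = ∀ x y z → _≺_ P x y → _≺_ P y z → ⊥

IsBijection : ∀ {m} → (Fin m → Fin m) → Set
IsBijection f = (∀ x y → f x ≡ f y → x ≡ y) × (∀ y → ∃ λ x → f x ≡ y)

-- Linear extension.  Labels are taken in Fin m = {0,…,m-1}; label k here
-- corresponds to the paper's label k+1 in [m].
IsLinearExtension : ∀ {m} → FinPoset m → (Fin m → Fin m) → Set
IsLinearExtension P ℓ =
  IsBijection ℓ × (∀ x y → _≺_ P x y → toℕ (ℓ x) < toℕ (ℓ y))

isBijection? : ∀ {m} (f : Fin m → Fin m) → Dec (IsBijection f)
isBijection? f =
  all? (λ x → all? (λ y → (f x ≟ᶠ f y) →-dec (x ≟ᶠ y)))
  ×-dec all? (λ y → any? (λ x → f x ≟ᶠ y))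

isLinearExtension? : ∀ {m} (P : FinPoset m) (ℓ : Fin m → Fin m) →
                     Dec (IsLinearExtension P ℓ)
isLinearExtension? P ℓ =
  isBijection? ℓ
  ×-dec all? (λ x → all? (λ y →
          (_≺?_ P x y) →-dec (toℕ (ℓ x) <? toℕ (ℓ y))))

allVecs : ∀ n k → List (Vec (Fin k) n)
allVecs zero    k = [ [] ]
allVecs (suc n) k = concatMap (λ v → map (_∷ v) (allFin k)) (allVecs n k)

e : ∀ {m} → FinPoset m → ℕ
e {m} P = length (filter (λ v → isLinearExtension? P (lookup v)) (allVecs m m))

Cover : ∀ {m} → FinPoset m → (Fin m → Set) → Fin m → Fin m → Set
Cover P S x y =
  S x × S y × _≺_ P x y × ¬ (∃ λ z → S z × _≺_ P x z × _≺_ P z y)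

data Reach {m} (P : FinPoset m) (S : Fin m → Set) : Fin m → Fin m → Set where
  here : ∀ {x} → S x → Reach P S x x
  step : ∀ {x y z} → Reach P S x y → (Cover P S y z ⊎ Cover P S z y) →
         Reach P S x z

-- The induced subposet on S is connected (its Hasse diagram is connected).
InducedConnected : ∀ {m} → FinPoset m → (Fin m → Set) → Set
InducedConnected P S = ∀ x y → S x → S y → Reach P S x y

-- Elements whose paper-label lies in {(i-1)q+1, …, iq}, i.e. whose 0-based
-- label lies in {(i-1)q, …, iq-1}.
Block : ∀ {m} → (Fin m → Fin m) → ℕ → ℕ → Fin m → Set
Block ℓ q i x = (i ∸ 1) * q ≤ toℕ (ℓ x) × toℕ (ℓ x) < i * q

-- Suppose no linear extension ℓ is adapted, and let j be the first block (labels jq, …, jq+q−1)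
-- of ℓ whose induced subposet is disconnected. Reading the block in label order, mark each
-- element by whether it lies in the component A of a canonical element; this gives a binary word
-- w of length q that is not constant. Comparable elements of the block are never separated by A,
-- so relabelling the block such that the word is rotated cyclically by one position, each letter
-- class keeping its order, gives another linear extension σ ℓ with the same blocks, hence the same
-- j and A. Then σ is injective, and since q is prime the statistic r⁻¹ · Σ p·w(p) mod q (r the
-- number of ones of w) decreases by one under σ. So the q residue classes of this statistic are
-- equally large and q divides e(P). Height 2 enters only to identify connectivity of the
-- comparability graph of a block with connectivity of its Hasse diagram.

module Submission where

open import Defs
open import Data.Nat
  using (ℕ; zero; suc; pred; _+_; _*_; _∸_; _%_; _/_; _≤_; _<_; z≤n; s≤s; s<s⁻¹; _≟_; _<?_; NonZero; >-nonZero; >-nonZero⁻¹)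
open import Data.Nat.Properties
open import Data.Nat.DivMod
open import Data.Nat.Divisibility using (_∣_; divides)
open import Data.Nat.Primality using (Prime)
open import Data.Nat.Coprimality using (prime⇒coprime; coprime-Bézout)
open import Data.Nat.GCD using (module Bézout)
open import Data.Nat.Solver using (module +-*-Solver)
open import Data.Fin using (Fin; toℕ; fromℕ<)
open import Data.Fin.Properties using (toℕ<n; toℕ-fromℕ; toℕ-fromℕ<; toℕ-inject₁; toℕ-injective; any?; all?; ¬∀⟶∃¬)
open import Data.List using (List; []; _∷_; filter; length; map; allFin)
open import Data.List.Properties using (length-removeAt′)
open import Data.List.Membership.Propositional using (_─_) renaming (_∈_ to _∈ₗ_)
open import Data.List.Membership.Propositional.Properties
  using (∈-filter⁺; ∈-filter⁻; ∈-map⁺; ∈-map⁻; ∈-concat⁺′; ∈-allFin)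
open import Data.List.Relation.Unary.Any as Any using (here; there; satisfied)
open import Data.List.Relation.Binary.Disjoint.Propositional using (Disjoint)
import Data.List.Relation.Unary.AllPairs as AllPairs
import Data.List.Relation.Unary.AllPairs.Properties as AllPairs
open import Data.List.Relation.Unary.All as All using (All; []; _∷_)
open import Data.List.Relation.Unary.Unique.Propositional using (Unique)
open import Data.List.Relation.Unary.AllPairs using ([]; _∷_)
import Data.List.Relation.Unary.Unique.Propositional.Properties as Unique
open import Data.Bool using (Bool; true; false; if_then_else_)
open import Data.Bool.Properties using (¬-not) renaming (_≟_ to _≟ᵇ_)
open import Data.Empty using (⊥; ⊥-elim)
open import Data.Fin.Subset using (Subset; _∈_; _∉_; _⊆_; _⊂_; ⁅_⁆; ∣_∣) renaming (⊥ to ∅)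
open import Data.Fin.Subset.Properties
  using (_∈?_; nonempty?; ∉⊥; ⊆-antisym; p⊂q⇒∣p∣<∣q∣; ∣p∣≤n; x∈⁅x⁆; x∈⁅y⁆⇒x≡y)
open import Data.Vec using (Vec; []; _∷_; lookup; tabulate)
open import Data.Vec.Properties using (lookup∘tabulate; tabulate∘lookup; tabulate-cong; []=⇒lookup; lookup⇒[]=)
open import Data.Nat.GeneralisedArithmetic using (fold)
open import Relation.Binary.Construct.Closure.Equivalence using (EqClosure)
import Relation.Binary.Construct.Closure.Equivalence as EqClosure
open import Relation.Binary.Construct.Closure.ReflexiveTransitive using (ε; _◅_; _◅◅_)
open import Relation.Binary.Construct.Closure.Symmetric using (SymClosure; fwd; bwd)
open import Data.Product using (Σ; ∃; _×_; _,_; proj₁; proj₂; uncurry)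
open import Data.Sum using (_⊎_; inj₁; inj₂)
import Data.Sum as Sum
open import Level using (0ℓ)
open import Function using (id; _∘_)
open import Relation.Nullary using (¬_; Dec; yes; no; does; _×-dec_; _⊎-dec_; _→-dec_; contradiction)
open import Relation.Nullary.Decidable using (dec-true; dec-false)
open import Relation.Unary using (Pred; Decidable)
open import Relation.Binary.PropositionalEquality
open import Relation.Binary using (Rel; tri<; tri≈; tri>) renaming (Decidable to Decidable₂)
open import Algebra.Properties.CommutativeMonoid.Sum +-0-commutativeMonoid
  using (sum-syntax; sum-cong-≗; sum-replicate-zero; sum-init-last; ∑-distrib-+)

-- Counting via injections and residues

module _ {a} {X : Set a} where

  ∈-─ : ∀ {x y} {ys : List X} (x∈ys : x ∈ₗ ys) → y ∈ₗ ys → y ≢ x → y ∈ₗ ys ─ x∈ys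
  ∈-─ (here refl) (here refl) y≢x = contradiction refl y≢x
  ∈-─ (here _)    (there y∈) _    = y∈
  ∈-─ (there _)   (here refl) _   = here refl
  ∈-─ (there x∈)  (there y∈) y≢x  = there (∈-─ x∈ y∈ y≢x)

  length-≤-injection : ∀ {p} {A : Pred X p} (f : X → X) {xs ys : List X} →
    Unique xs → All A xs → (∀ {u v} → A u → A v → f u ≡ f v → u ≡ v) →
    (∀ {x} → x ∈ₗ xs → f x ∈ₗ ys) → length xs ≤ length ys
  length-≤-injection f {[]}     _          _          _   _    = z≤n
  length-≤-injection f {x ∷ xs} {ys} (x∉xs ∷ uxs) (ax ∷ axs) inj f∈ = begin
    suc (length xs)                  ≤⟨ s≤s (length-≤-injection f uxs axs inj f∈─) ⟩
    suc (length (ys ─ f∈ (here refl))) ≡⟨ length-removeAt′ ys _ ⟨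
    length ys                        ∎
    where
    open ≤-Reasoning
    f∈─ : ∀ {y} → y ∈ₗ xs → f y ∈ₗ ys ─ f∈ (here refl)
    f∈─ y∈xs = ∈-─ (f∈ (here refl)) (f∈ (there y∈xs))
      λ fy≡fx → All.lookup x∉xs y∈xs (sym (inj (All.lookup axs y∈xs) ax fy≡fx))

  module _ {p} {A B : Pred X p} (A? : Decidable A) (B? : Decidable B) where

    length-filter-≤ : ∀ {xs} → Unique xs → (∀ x → x ∈ₗ xs) → (f : X → X) →
      (∀ {x} → A x → B (f x)) → (∀ {u v} → A u → A v → f u ≡ f v → u ≡ v) →
      length (filter A? xs) ≤ length (filter B? xs)
    length-filter-≤ {xs} uxs complete f f-AB inj =
      length-≤-injection f (Unique.filter⁺ A? uxs) (All.tabulate (proj₂ ∘ ∈-filter⁻ A? {xs = xs})) inj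
        (λ x∈ → ∈-filter⁺ B? (complete _) (f-AB (proj₂ (∈-filter⁻ A? {xs = xs} x∈))))

allVecs-complete : ∀ n k (v : Vec (Fin k) n) → v ∈ₗ allVecs n k
allVecs-complete zero    k []      = here refl
allVecs-complete (suc n) k (x ∷ v) =
  ∈-concat⁺′ (∈-map⁺ (_∷ v) (∈-allFin x)) (∈-map⁺ (λ v → map (_∷ v) (allFin k)) (allVecs-complete n k v))

allVecs-unique : ∀ n k → Unique (allVecs n k)
allVecs-unique zero    k = [] ∷ []
allVecs-unique (suc n) k = Unique.concat⁺ (All.tabulate unique-row) (AllPairs.map⁺ (AllPairs.map disjoint-rows (allVecs-unique n k)))
  where
  unique-row : ∀ {row} → row ∈ₗ map (λ v → map (_∷ v) (allFin k)) (allVecs n k) → Unique row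
  unique-row row∈ with ∈-map⁻ _ row∈
  ... | v , _ , refl = Unique.map⁺ (λ { refl → refl }) (Unique.allFin⁺ k)
  disjoint-rows : ∀ {v w : Vec (Fin k) n} → v ≢ w → Disjoint (map (_∷ v) (allFin k)) (map (_∷ w) (allFin k))
  disjoint-rows v≢w (u∈v-row , u∈w-row) with ∈-map⁻ (_∷ _) u∈v-row | ∈-map⁻ (_∷ _) u∈w-row
  ... | _ , _ , refl | _ , _ , refl = v≢w refl

bit : Bool → ℕ
bit b = if b then 1 else 0

𝟙 : ∀ {p} {P : Set p} → Dec P → ℕ
𝟙 d = bit (does d)

length-filter-∷ : ∀ {a p} {X : Set a} {P : Pred X p} (P? : Decidable P) x xs →
  length (filter P? (x ∷ xs)) ≡ 𝟙 (P? x) + length (filter P? xs)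
length-filter-∷ P? x xs with does (P? x)
... | true  = refl
... | false = refl

∑-const : ∀ n c → ∑[ k < n ] c ≡ n * c
∑-const zero    c = refl
∑-const (suc n) c = cong (c +_) (∑-const n c)

∑-indicator : ∀ {n} r → r < n → ∑[ k < n ] 𝟙 (r ≟ toℕ k) ≡ 1
∑-indicator {suc n} zero    _          = cong suc (sum-replicate-zero n)
∑-indicator {suc n} (suc r) (s≤s r<n) = ∑-indicator r r<n

module ResidueCounting (q : ℕ) .⦃ _ : NonZero q ⦄ where

  %-cancel-suc : ∀ a b → suc a % q ≡ suc b % q → a % q ≡ b % q
  %-cancel-suc a b eq = begin
    a % q                              ≡⟨ via-suc a ⟩
    (suc a % q + (q ∸ 1) % q) % q     ≡⟨ cong (λ r → (r + (q ∸ 1) % q) % q) eq ⟩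
    (suc b % q + (q ∸ 1) % q) % q     ≡⟨ via-suc b ⟨
    b % q                              ∎
    where
    open ≡-Reasoning
    via-suc : ∀ c → c % q ≡ (suc c % q + (q ∸ 1) % q) % q
    via-suc c = begin
      c % q                ≡⟨ [m+n]%n≡m%n c q ⟨
      (c + q) % q          ≡⟨ cong (λ n → (c + n) % q) (m+[n∸m]≡n (>-nonZero⁻¹ q)) ⟨
      (c + (1 + (q ∸ 1))) % q ≡⟨ cong (_% q) (+-suc c (q ∸ 1)) ⟩
      (suc c + (q ∸ 1)) % q   ≡⟨ %-distribˡ-+ (suc c) (q ∸ 1) q ⟩
      (suc c % q + (q ∸ 1) % q) % q ∎

  module _ {a p} {X : Set a} {Q : Pred X p} (Q? : Decidable Q) (h : X → ℕ) where

    InClass : ℕ → Pred X p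
    InClass k x = Q x × h x % q ≡ k % q

    inClass? : ∀ k → Decidable (InClass k)
    inClass? k x = Q? x ×-dec (h x % q ≟ k % q)

    length-filter-∑ : ∀ xs → length (filter Q? xs) ≡ ∑[ k < q ] length (filter (inClass? (toℕ k)) xs)
    length-filter-∑ []       = sym (sum-replicate-zero q)
    length-filter-∑ (x ∷ xs) = begin
      length (filter Q? (x ∷ xs))                                  ≡⟨ length-filter-∷ Q? x xs ⟩
      𝟙 (Q? x) + length (filter Q? xs)                             ≡⟨ cong₂ _+_ (split x) (length-filter-∑ xs) ⟩
      ∑[ k < q ] 𝟙 (inClass? (toℕ k) x) + ∑[ k < q ] length (filter (inClass? (toℕ k)) xs)
        ≡⟨ ∑-distrib-+ {q} (λ k → 𝟙 (inClass? (toℕ k) x)) (λ k → length (filter (inClass? (toℕ k)) xs)) ⟨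
      ∑[ k < q ] (𝟙 (inClass? (toℕ k) x) + length (filter (inClass? (toℕ k)) xs))
        ≡⟨ sum-cong-≗ {q} (λ k → length-filter-∷ (inClass? (toℕ k)) x xs) ⟨
      ∑[ k < q ] length (filter (inClass? (toℕ k)) (x ∷ xs))
        ∎
      where
      open ≡-Reasoning
      split : ∀ x → 𝟙 (Q? x) ≡ ∑[ k < q ] 𝟙 (inClass? (toℕ k) x)
      split x with Q? x
      ... | no _  = sym (sum-replicate-zero q)
      ... | yes _ = begin
        1                                   ≡⟨ ∑-indicator (h x % q) (m%n<n (h x) q) ⟨
        ∑[ k < q ] 𝟙 (h x % q ≟ toℕ k)
          ≡⟨ sum-cong-≗ (λ k → cong (𝟙 ∘ (h x % q ≟_)) (m<n⇒m%n≡m (toℕ<n k))) ⟨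
        ∑[ k < q ] 𝟙 (h x % q ≟ toℕ k % q)  ∎

    -- σ maps residue class k+1 injectively into class k, and class 0 into class q,
    -- so all q classes have the same size.
    q∣length-filter : ∀ {xs} → Unique xs → (∀ x → x ∈ₗ xs) → (σ : X → X) →
      (∀ {x} → Q x → Q (σ x)) → (∀ {u v} → Q u → Q v → σ u ≡ σ v → u ≡ v) →
      (∀ {x} → Q x → suc (h (σ x)) % q ≡ h x % q) → q ∣ length (filter Q? xs)
    q∣length-filter {xs} uxs complete σ σ-Q σ-inj σ-h =
      divides (N 0) (trans (length-filter-∑ xs) (trans (sum-cong-≗ (N-const ∘ <⇒≤ ∘ toℕ<n))
        (trans (∑-const q (N 0)) (*-comm q (N 0)))))
      where
      N : ℕ → ℕ
      N k = length (filter (inClass? k) xs)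

      N-suc : ∀ k → N (suc k) ≤ N k
      N-suc k = length-filter-≤ (inClass? (suc k)) (inClass? k) uxs complete σ
        (λ (Qx , hx) → σ-Q Qx , %-cancel-suc (h (σ _)) k (trans (σ-h Qx) hx))
        (λ u v → σ-inj (proj₁ u) (proj₁ v))

      N-wrap : N 0 ≤ N q
      N-wrap = length-filter-≤ (inClass? 0) (inClass? q) uxs complete id
        (λ (Qx , hx) → Qx , trans hx (trans (m<n⇒m%n≡m (>-nonZero⁻¹ q)) (sym (n%n≡0 q))))
        (λ _ _ → id)

      N-anti : ∀ {j k} → k ≤ j → N j ≤ N k
      N-anti {zero}  z≤n   = ≤-refl
      N-anti {suc j} k≤1+j with m≤n⇒m<n∨m≡n k≤1+j
      ... | inj₁ (s≤s k≤j) = ≤-trans (N-suc j) (N-anti k≤j)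
      ... | inj₂ refl      = ≤-refl

      N-const : ∀ {k} → k ≤ q → N k ≡ N 0
      N-const k≤q = ≤-antisym (N-anti z≤n) (≤-trans N-wrap (N-anti k≤q))

-- Binary words

ones : ∀ n → (ℕ → Bool) → ℕ
ones n w = ∑[ i < n ] bit (w (toℕ i))

weight : ∀ n → (ℕ → Bool) → ℕ
weight n w = ∑[ i < n ] (toℕ i * bit (w (toℕ i)))

ones-≤ : ∀ n w → ones n w ≤ n
ones-≤ zero    w = z≤n
ones-≤ (suc n) w with w 0
... | true  = s≤s (ones-≤ n (w ∘ suc))
... | false = m≤n⇒m≤1+n (ones-≤ n (w ∘ suc))

ones-pos : ∀ {n w p} → p < n → w p ≡ true → 0 < ones n w
ones-pos {suc n} {w} {zero}  _         w0≡true rewrite w0≡true = s≤s z≤n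
ones-pos {suc n} {w} {suc p} (s≤s p<n) wp≡true =
  ≤-trans (ones-pos {n} {w ∘ suc} p<n wp≡true) (m≤n+m _ (bit (w 0)))

ones-< : ∀ {n w p} → p < n → w p ≡ false → ones n w < n
ones-< {suc n} {w} {zero}  _         w0≡false rewrite w0≡false = s≤s (ones-≤ n (w ∘ suc))
ones-< {suc n} {w} {suc p} (s≤s p<n) wp≡false with w 0
... | true  = s≤s (ones-< {n} {w ∘ suc} p<n wp≡false)
... | false = m≤n⇒m≤1+n (ones-< {n} {w ∘ suc} p<n wp≡false)

IsLeftRotation : ℕ → (ℕ → Bool) → (ℕ → Bool) → Set
IsLeftRotation n w w′ = (∀ t → suc t < n → w′ t ≡ w (suc t)) × (∀ t → suc t ≡ n → w′ t ≡ w 0)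

left-rotation-unique : ∀ {n w₁ w₂ w′} → IsLeftRotation n w₁ w′ → IsLeftRotation n w₂ w′ →
  ∀ {t} → t < n → w₁ t ≡ w₂ t
left-rotation-unique {suc k} (_ , wrap₁) (_ , wrap₂) {zero}  _      = trans (sym (wrap₁ k refl)) (wrap₂ k refl)
left-rotation-unique (shift₁ , _) (shift₂ , _)      {suc t} t+1<n = trans (sym (shift₁ t t+1<n)) (shift₂ t t+1<n)

module _ {k} {w w′ : ℕ → Bool} (rotation : IsLeftRotation (suc k) w w′) where

  private
    tail-ones tail-weight : ℕ
    tail-ones   = ∑[ i < k ] bit (w (suc (toℕ i)))
    tail-weight = ∑[ i < k ] (toℕ i * bit (w (suc (toℕ i))))

    split-last : (g : ℕ → ℕ) → ∑[ i < suc k ] g (toℕ i) ≡ ∑[ i < k ] g (toℕ i) + g k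
    split-last g = trans (sum-init-last (g ∘ toℕ))
      (cong₂ _+_ (sum-cong-≗ {k} (cong g ∘ toℕ-inject₁)) (cong g (toℕ-fromℕ k)))

    shift-under-∑ : (f : ℕ → ℕ → ℕ) →
      ∑[ i < k ] f (toℕ i) (bit (w′ (toℕ i))) ≡ ∑[ i < k ] f (toℕ i) (bit (w (suc (toℕ i))))
    shift-under-∑ f = sum-cong-≗ {k} (λ i → cong (f (toℕ i) ∘ bit) (proj₁ rotation (toℕ i) (s≤s (toℕ<n i))))

  ones-rotation : ones (suc k) w′ ≡ ones (suc k) w
  ones-rotation = begin
    ones (suc k) w′                          ≡⟨ split-last (bit ∘ w′) ⟩
    ∑[ i < k ] bit (w′ (toℕ i)) + bit (w′ k)
      ≡⟨ cong₂ _+_ (shift-under-∑ λ _ b → b) (cong bit (proj₂ rotation k refl)) ⟩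
    tail-ones + bit (w 0)                    ≡⟨ +-comm tail-ones (bit (w 0)) ⟩
    ones (suc k) w                           ∎
    where open ≡-Reasoning

  weight-rotation : weight (suc k) w′ + ones (suc k) w ≡ weight (suc k) w + suc k * bit (w 0)
  weight-rotation = begin
    weight (suc k) w′ + ones (suc k) w
      ≡⟨ cong (_+ ones (suc k) w) (split-last (λ t → t * bit (w′ t))) ⟩
    ∑[ i < k ] (toℕ i * bit (w′ (toℕ i))) + k * bit (w′ k) + (bit (w 0) + tail-ones)
      ≡⟨ cong (_+ (bit (w 0) + tail-ones))
           (cong₂ _+_ (shift-under-∑ _*_) (cong (λ b → k * bit b) (proj₂ rotation k refl))) ⟩
    tail-weight + k * bit (w 0) + (bit (w 0) + tail-ones)
      ≡⟨ solve 4 (λ s₁ s₂ b k → s₂ :+ k :* b :+ (b :+ s₁) := s₁ :+ s₂ :+ (b :+ k :* b))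
               refl tail-ones tail-weight (bit (w 0)) k ⟩
    tail-ones + tail-weight + suc k * bit (w 0)
      ≡⟨ cong (_+ suc k * bit (w 0))
           (∑-distrib-+ {k} (λ i → bit (w (suc (toℕ i)))) (λ i → toℕ i * bit (w (suc (toℕ i))))) ⟨
    weight (suc k) w + suc k * bit (w 0)
      ∎
    where
    open ≡-Reasoning
    open +-*-Solver using (solve; _:+_; _:*_; _:=_)

module ModularInverse (q : ℕ) .⦃ _ : NonZero q ⦄ where

  inverse : ℕ → ℕ
  inverse r with any? (λ (c : Fin q) → (toℕ c * r) % q ≟ 1 % q)
  ... | yes (c , _) = toℕ c
  ... | no _        = 0

  private
    inverse-exists : Prime q → ∀ {r} → 0 < r → r < q → ∃ λ c → (c * r) % q ≡ 1 % q
    inverse-exists q-prime {r@(suc _)} _ r<q with coprime-Bézout (prime⇒coprime q-prime r<q)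
    ... | Bézout.-+ x y 1+xq≡yr = y , (begin
      (y * r) % q          ≡⟨ cong (_% q) 1+xq≡yr ⟨
      (1 + x * q) % q      ≡⟨ [m+kn]%n≡m%n 1 x q ⟩
      1 % q                ∎)
      where open ≡-Reasoning
    -- from 1 + y r = x q: (q - 1) y r + q = 1 + (q - 1) x q
    ... | Bézout.+- x y 1+yr≡xq = (q ∸ 1) * y , (begin
      ((q ∸ 1) * y * r) % q                       ≡⟨ [m+n]%n≡m%n ((q ∸ 1) * y * r) q ⟨
      ((q ∸ 1) * y * r + q) % q                   ≡⟨ cong (λ n → ((q ∸ 1) * y * r + n) % q) q≡1+[q∸1] ⟩
      ((q ∸ 1) * y * r + (1 + (q ∸ 1))) % q
        ≡⟨ cong (_% q) (solve 3 (λ k y r → k :* y :* r :+ (con 1 :+ k) := con 1 :+ k :* (con 1 :+ y :* r))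
                              refl (q ∸ 1) y r) ⟩
      (1 + (q ∸ 1) * (1 + y * r)) % q             ≡⟨ cong (λ n → (1 + (q ∸ 1) * n) % q) 1+yr≡xq ⟩
      (1 + (q ∸ 1) * (x * q)) % q                 ≡⟨ cong (λ n → (1 + n) % q) (*-assoc (q ∸ 1) x q) ⟨
      (1 + (q ∸ 1) * x * q) % q                   ≡⟨ [m+kn]%n≡m%n 1 ((q ∸ 1) * x) q ⟩
      1 % q                                       ∎)
      where
      open ≡-Reasoning
      open +-*-Solver using (solve; _:+_; _:*_; _:=_; con)
      q≡1+[q∸1] : q ≡ 1 + (q ∸ 1)
      q≡1+[q∸1] = sym (m+[n∸m]≡n (>-nonZero⁻¹ q))

  inverse-spec : Prime q → ∀ {r} → 0 < r → r < q → (inverse r * r) % q ≡ 1 % q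
  inverse-spec q-prime {r} 0<r r<q with any? (λ (c : Fin q) → (toℕ c * r) % q ≟ 1 % q)
  ... | yes (_ , cr≡1) = cr≡1
  ... | no ∄c = contradiction (fromℕ< (m%n<n c q) , reduced) ∄c
    where
    c = proj₁ (inverse-exists q-prime 0<r r<q)
    reduced : (toℕ (fromℕ< (m%n<n c q)) * r) % q ≡ 1 % q
    reduced = begin
      (toℕ (fromℕ< (m%n<n c q)) * r) % q ≡⟨ cong (λ n → (n * r) % q) (toℕ-fromℕ< (m%n<n c q)) ⟩
      (c % q * r) % q                   ≡⟨ %-distribˡ-* (c % q) r q ⟩
      (c % q % q * (r % q)) % q         ≡⟨ cong (λ n → (n * (r % q)) % q) (m%n%n≡m%n c q) ⟩
      (c % q * (r % q)) % q             ≡⟨ %-distribˡ-* c r q ⟨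
      (c * r) % q                       ≡⟨ proj₂ (inverse-exists q-prime 0<r r<q) ⟩
      1 % q                             ∎
      where open ≡-Reasoning

-- A left rotation lowers the weight by the number of ones modulo q;
-- dividing by that number makes the drop exactly one.
statistic : ∀ q .⦃ _ : NonZero q ⦄ → (ℕ → Bool) → ℕ
statistic q w = ModularInverse.inverse q (ones q w) * weight q w

statistic-rotation : ∀ q .⦃ _ : NonZero q ⦄ {w w′ : ℕ → Bool} → Prime q → IsLeftRotation q w w′ →
  0 < ones q w → ones q w < q → suc (statistic q w′) % q ≡ statistic q w % q
statistic-rotation q@(suc k) {w} {w′} q-prime rotation 0<r r<q = begin
  suc (inverse (ones q w′) * weight q w′) % q
    ≡⟨ cong (λ r → suc (inverse r * weight q w′) % q) (ones-rotation {w = w} {w′} rotation) ⟩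
  suc (c * weight q w′) % q                        ≡⟨ cong (_% q) (+-comm 1 (c * weight q w′)) ⟩
  (c * weight q w′ + 1) % q                        ≡⟨ %-distribˡ-+ (c * weight q w′) 1 q ⟩
  ((c * weight q w′) % q + 1 % q) % q
    ≡⟨ cong (λ n → ((c * weight q w′) % q + n) % q) (inverse-spec q-prime 0<r r<q) ⟨
  ((c * weight q w′) % q + (c * ones q w) % q) % q ≡⟨ %-distribˡ-+ (c * weight q w′) (c * ones q w) q ⟨
  (c * weight q w′ + c * ones q w) % q             ≡⟨ cong (_% q) (*-distribˡ-+ c (weight q w′) (ones q w)) ⟨
  (c * (weight q w′ + ones q w)) % q               ≡⟨ cong (λ n → (c * n) % q) (weight-rotation {w = w} {w′} rotation) ⟩
  (c * (weight q w + q * bit (w 0))) % q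
    ≡⟨ cong (_% q) (solve 4 (λ c s q b → c :* (s :+ q :* b) := c :* s :+ (c :* b) :* q) refl c (weight q w) q (bit (w 0))) ⟩
  (c * weight q w + c * bit (w 0) * q) % q         ≡⟨ [m+kn]%n≡m%n (c * weight q w) (c * bit (w 0)) q ⟩
  (c * weight q w) % q                             ∎
  where
  open ModularInverse q
  open ≡-Reasoning
  open +-*-Solver using (solve; _:+_; _:*_; _:=_)
  c : ℕ
  c = inverse (ones q w)

-- rotate is the permutation of the positions 0, …, q−1 of the word w that shifts w cyclically
-- one place to the left while keeping the positions of each letter in order: a position carrying
-- the letter of position 0 moves to just before the next such position (or to q−1), any other
-- position p moves to p−1.
module Rotation (q : ℕ) (w : ℕ → Bool) where

  Marked : ℕ → Set
  Marked p = w p ≡ w 0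

  marked? : ∀ p → Dec (Marked p)
  marked? p = w p ≟ᵇ w 0

  firstMarkedFrom : ℕ → ℕ → ℕ
  firstMarkedFrom k zero    = k
  firstMarkedFrom k (suc n) = if does (marked? k) then k else firstMarkedFrom (suc k) n

  firstMarkedFrom-≥ : ∀ k n → k ≤ firstMarkedFrom k n
  firstMarkedFrom-≥ k zero    = ≤-refl
  firstMarkedFrom-≥ k (suc n) with marked? k
  ... | yes _ = ≤-refl
  ... | no  _ = <⇒≤ (firstMarkedFrom-≥ (suc k) n)

  firstMarkedFrom-≤ : ∀ k n → firstMarkedFrom k n ≤ k + n
  firstMarkedFrom-≤ k zero    = m≤m+n k 0
  firstMarkedFrom-≤ k (suc n) with marked? k
  ... | yes _ = m≤m+n k (suc n)
  ... | no  _ = ≤-trans (firstMarkedFrom-≤ (suc k) n) (≤-reflexive (sym (+-suc k n)))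

  firstMarkedFrom-marked : ∀ k n → firstMarkedFrom k n < k + n → Marked (firstMarkedFrom k n)
  firstMarkedFrom-marked k zero    k<k+0 = contradiction (≤-reflexive (+-identityʳ k)) (<⇒≱ k<k+0)
  firstMarkedFrom-marked k (suc n) f<    with marked? k
  ... | yes marked = marked
  ... | no  _      = firstMarkedFrom-marked (suc k) n (≤-trans f< (≤-reflexive (+-suc k n)))

  firstMarkedFrom-gap : ∀ k n {i} → k ≤ i → i < firstMarkedFrom k n → ¬ Marked i
  firstMarkedFrom-gap k zero    k≤i i<k = contradiction k≤i (<⇒≱ i<k)
  firstMarkedFrom-gap k (suc n) k≤i i<f with marked? k
  ... | yes _        = contradiction k≤i (<⇒≱ i<f)
  ... | no unmarked with m≤n⇒m<n∨m≡n k≤i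
  ...   | inj₁ k<i  = firstMarkedFrom-gap (suc k) n k<i i<f
  ...   | inj₂ refl = unmarked

  nextMarked : ℕ → ℕ
  nextMarked p = firstMarkedFrom (suc p) (q ∸ suc p)

  module _ {p} (p<q : p < q) where

    private
      bound : suc p + (q ∸ suc p) ≡ q
      bound = m+[n∸m]≡n p<q

    nextMarked-> : p < nextMarked p
    nextMarked-> = firstMarkedFrom-≥ (suc p) (q ∸ suc p)

    nextMarked-≤ : nextMarked p ≤ q
    nextMarked-≤ = ≤-trans (firstMarkedFrom-≤ (suc p) (q ∸ suc p)) (≤-reflexive bound)

    nextMarked-marked : nextMarked p < q → Marked (nextMarked p)
    nextMarked-marked n<q = firstMarkedFrom-marked (suc p) (q ∸ suc p) (≤-trans n<q (≤-reflexive (sym bound)))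

    nextMarked-gap : ∀ {i} → p < i → i < nextMarked p → ¬ Marked i
    nextMarked-gap = firstMarkedFrom-gap (suc p) (q ∸ suc p)

    nextMarked-≤-marked : ∀ {i} → p < i → Marked i → nextMarked p ≤ i
    nextMarked-≤-marked p<i marked = ≮⇒≥ (λ i<n → nextMarked-gap p<i i<n marked)

  lastMarked : ℕ → ℕ
  lastMarked zero    = 0
  lastMarked (suc t) = if does (marked? (suc t)) then suc t else lastMarked t

  lastMarked-≤ : ∀ t → lastMarked t ≤ t
  lastMarked-≤ zero    = z≤n
  lastMarked-≤ (suc t) with marked? (suc t)
  ... | yes _ = ≤-refl
  ... | no  _ = m≤n⇒m≤1+n (lastMarked-≤ t)

  lastMarked-marked : ∀ t → Marked (lastMarked t)
  lastMarked-marked zero    = refl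
  lastMarked-marked (suc t) with marked? (suc t)
  ... | yes marked = marked
  ... | no  _      = lastMarked-marked t

  lastMarked-gap : ∀ t {i} → lastMarked t < i → i ≤ t → ¬ Marked i
  lastMarked-gap zero    l<i i≤0 = contradiction i≤0 (<⇒≱ l<i)
  lastMarked-gap (suc t) l<i i≤t+1 with marked? (suc t)
  ... | yes _ = contradiction i≤t+1 (<⇒≱ l<i)
  ... | no unmarked with m≤n⇒m<n∨m≡n i≤t+1
  ...   | inj₁ (s≤s i≤t) = lastMarked-gap t l<i i≤t
  ...   | inj₂ refl      = unmarked

  nextMarked-lastMarked : ∀ {t} → t < q → (suc t < q → Marked (suc t)) → nextMarked (lastMarked t) ≡ suc t
  nextMarked-lastMarked {t} t<q marked-after with <-cmp (nextMarked (lastMarked t)) (suc t)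
  ... | tri≈ _ n≡t+1 _ = n≡t+1
  ... | tri< (s≤s n≤t) _ _ =
    contradiction (nextMarked-marked l<q (≤-<-trans n≤t t<q)) (lastMarked-gap t (nextMarked-> l<q) n≤t)
    where l<q = ≤-<-trans (lastMarked-≤ t) t<q
  ... | tri> _ _ t+1<n =
    contradiction (marked-after (<-≤-trans t+1<n (nextMarked-≤ l<q))) (nextMarked-gap l<q (s≤s (lastMarked-≤ t)) t+1<n)
    where l<q = ≤-<-trans (lastMarked-≤ t) t<q

  rotate : ℕ → ℕ
  rotate p = if does (marked? p) then pred (nextMarked p) else pred p

  suc-rotate-marked : ∀ {p} → p < q → Marked p → suc (rotate p) ≡ nextMarked p
  suc-rotate-marked {p} p<q marked with marked? p
  ... | yes _       = suc-pred (nextMarked p) ⦃ >-nonZero (≤-<-trans z≤n (nextMarked-> p<q)) ⦄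
  ... | no unmarked = contradiction marked unmarked

  suc-rotate-unmarked : ∀ {p} → ¬ Marked p → suc (rotate p) ≡ p
  suc-rotate-unmarked {zero}  unmarked = contradiction refl unmarked
  suc-rotate-unmarked {suc p} unmarked with marked? (suc p)
  ... | yes marked = contradiction marked unmarked
  ... | no _       = refl

  rotate-< : ∀ {p} → p < q → rotate p < q
  rotate-< {p} p<q = by-marking (marked? p)
    where
    by-marking : Dec (Marked p) → rotate p < q
    by-marking (yes marked)  = ≤-trans (≤-reflexive (suc-rotate-marked p<q marked)) (nextMarked-≤ p<q)
    by-marking (no unmarked) = ≤-trans (≤-reflexive (suc-rotate-unmarked unmarked)) (<⇒≤ p<q)

  rotate-monotone : ∀ {p p′} → p < p′ → p′ < q → w p ≡ w p′ → rotate p < rotate p′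
  rotate-monotone {p} {p′} p<p′ p′<q same = s<s⁻¹ (by-marking (marked? p′))
    where
    open ≤-Reasoning
    by-marking : Dec (Marked p′) → suc (rotate p) < suc (rotate p′)
    by-marking (yes marked′) = begin-strict
      suc (rotate p)  ≡⟨ suc-rotate-marked (<-trans p<p′ p′<q) (trans same marked′) ⟩
      nextMarked p    ≤⟨ nextMarked-≤-marked (<-trans p<p′ p′<q) p<p′ marked′ ⟩
      p′              <⟨ nextMarked-> p′<q ⟩
      nextMarked p′   ≡⟨ suc-rotate-marked p′<q marked′ ⟨
      suc (rotate p′) ∎
    by-marking (no unmarked′) = begin-strict
      suc (rotate p)  ≡⟨ suc-rotate-unmarked (unmarked′ ∘ trans (sym same)) ⟩
      p               <⟨ p<p′ ⟩
      p′              ≡⟨ suc-rotate-unmarked unmarked′ ⟨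
      suc (rotate p′) ∎

  private
    rotate-separates : ∀ {p p′} → p < p′ → p′ < q → rotate p ≢ rotate p′
    rotate-separates {p} {p′} p<p′ p′<q eq = by-marking (marked? p) (marked? p′)
      where
      p<q = <-trans p<p′ p′<q
      by-marking : Dec (Marked p) → Dec (Marked p′) → ⊥
      by-marking (yes marked) (yes marked′) =
        <-irrefl eq (rotate-monotone p<p′ p′<q (trans marked (sym marked′)))
      by-marking (no unmarked) (no unmarked′) =
        <-irrefl eq (rotate-monotone p<p′ p′<q (trans (¬-not unmarked) (sym (¬-not unmarked′))))
      by-marking (yes marked) (no unmarked′) =
        unmarked′ (subst Marked next≡p′ (nextMarked-marked p<q (subst (_< q) (sym next≡p′) p′<q)))
        where
        next≡p′ : nextMarked p ≡ p′
        next≡p′ = trans (sym (suc-rotate-marked p<q marked)) (trans (cong suc eq) (suc-rotate-unmarked unmarked′))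
      by-marking (no unmarked) (yes marked′) = <-asym p<p′ (<-≤-trans (nextMarked-> p′<q) (≤-reflexive next≡p))
        where
        next≡p : nextMarked p′ ≡ p
        next≡p = trans (sym (suc-rotate-marked p′<q marked′)) (trans (cong suc (sym eq)) (suc-rotate-unmarked unmarked))

  rotate-injective : ∀ {p p′} → p < q → p′ < q → rotate p ≡ rotate p′ → p ≡ p′
  rotate-injective {p} {p′} p<q p′<q eq with <-cmp p p′
  ... | tri≈ _ p≡p′ _ = p≡p′
  ... | tri< p<p′ _ _ = contradiction eq (rotate-separates p<p′ p′<q)
  ... | tri> _ _ p′<p = contradiction (sym eq) (rotate-separates p′<p p<q)

  rotate-lastMarked : ∀ {t} → t < q → (suc t < q → Marked (suc t)) → rotate (lastMarked t) ≡ t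
  rotate-lastMarked {t} t<q marked-after = suc-injective (begin
    suc (rotate (lastMarked t)) ≡⟨ suc-rotate-marked (≤-<-trans (lastMarked-≤ t) t<q) (lastMarked-marked t) ⟩
    nextMarked (lastMarked t)   ≡⟨ nextMarked-lastMarked t<q marked-after ⟩
    suc t                       ∎)
    where open ≡-Reasoning

  rotate-surjective : ∀ {t} → t < q → ∃ λ p → p < q × rotate p ≡ t
  rotate-surjective {t} t<q with suc t <? q
  ... | no t+1≮q = lastMarked t , ≤-<-trans (lastMarked-≤ t) t<q ,
                   rotate-lastMarked t<q (λ t+1<q → contradiction t+1<q t+1≮q)
  ... | yes t+1<q with marked? (suc t)
  ...   | yes marked  = lastMarked t , ≤-<-trans (lastMarked-≤ t) t<q , rotate-lastMarked t<q (λ _ → marked)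
  ...   | no unmarked = suc t , t+1<q , suc-injective (suc-rotate-unmarked unmarked)

  rotate-isLeftRotation : (w′ : ℕ → Bool) → (∀ {p} → p < q → w′ (rotate p) ≡ w p) → IsLeftRotation q w w′
  rotate-isLeftRotation w′ relabel = shift , wrap
    where
    shift : ∀ t → suc t < q → w′ t ≡ w (suc t)
    shift t t+1<q with rotate-surjective (<-trans (n<1+n t) t+1<q)
    ... | p , p<q , refl = trans (relabel p<q) (by-marking (marked? p))
      where
      by-marking : Dec (Marked p) → w p ≡ w (suc (rotate p))
      by-marking (yes marked) = begin
        w p                   ≡⟨ marked ⟩
        w 0                   ≡⟨ nextMarked-marked p<q (subst (_< q) (suc-rotate-marked p<q marked) t+1<q) ⟨
        w (nextMarked p)      ≡⟨ cong w (suc-rotate-marked p<q marked) ⟨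
        w (suc (rotate p))    ∎
        where open ≡-Reasoning
      by-marking (no unmarked) = cong w (sym (suc-rotate-unmarked unmarked))
    wrap : ∀ t → suc t ≡ q → w′ t ≡ w 0
    wrap t t+1≡q with rotate-surjective (≤-reflexive t+1≡q)
    ... | p , p<q , refl = trans (relabel p<q) (by-marking (marked? p))
      where
      by-marking : Dec (Marked p) → w p ≡ w 0
      by-marking (yes marked)  = marked
      by-marking (no unmarked) = contradiction (trans (sym (suc-rotate-unmarked unmarked)) t+1≡q) (<⇒≢ p<q)

module _ {q : ℕ} {w₁ w₂ : ℕ → Bool} (w₁≗w₂ : ∀ t → w₁ t ≡ w₂ t) where

  private
    module R₁ = Rotation q w₁
    module R₂ = Rotation q w₂

  firstMarkedFrom-cong : ∀ k n → R₁.firstMarkedFrom k n ≡ R₂.firstMarkedFrom k n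
  firstMarkedFrom-cong k zero    = refl
  firstMarkedFrom-cong k (suc n) rewrite w₁≗w₂ k | w₁≗w₂ 0 =
    cong (if does (w₂ k ≟ᵇ w₂ 0) then k else_) (firstMarkedFrom-cong (suc k) n)

  rotate-cong : ∀ p → R₁.rotate p ≡ R₂.rotate p
  rotate-cong p rewrite w₁≗w₂ p | w₁≗w₂ 0 =
    cong (λ n → if does (w₂ p ≟ᵇ w₂ 0) then pred n else pred p) (firstMarkedFrom-cong (suc p) (q ∸ suc p))

-- Connected components of finite graphs and induced subposets

subsetOf : ∀ {n p} {P : Pred (Fin n) p} → Decidable P → Subset n
subsetOf P? = tabulate (does ∘ P?)

module _ {n p} {P : Pred (Fin n) p} (P? : Decidable P) where

  ∈-subsetOf⁺ : ∀ {x} → P x → x ∈ subsetOf P?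
  ∈-subsetOf⁺ {x} px = lookup⇒[]= x _ (trans (lookup∘tabulate (does ∘ P?) x) (dec-true (P? x) px))

  ∈-subsetOf⁻ : ∀ {x} → x ∈ subsetOf P? → P x
  ∈-subsetOf⁻ {x} x∈ with P? x | trans (sym (lookup∘tabulate (does ∘ P?) x)) ([]=⇒lookup x∈)
  ... | yes px | _ = px

⊆-or-witness : ∀ {n} (R S : Subset n) → R ⊆ S ⊎ ∃ λ x → x ∈ R × x ∉ S
⊆-or-witness {n} R S with all? (λ x → x ∈? R →-dec x ∈? S)
... | yes R⊆S = inj₁ (R⊆S _)
... | no  R⊈S with ¬∀⟶∃¬ n _ (λ x → x ∈? R →-dec x ∈? S) R⊈S
...   | x , ¬[x∈R→x∈S] with x ∈? R
...     | yes x∈R = inj₂ (x , x∈R , λ x∈S → ¬[x∈R→x∈S] λ _ → x∈S)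
...     | no  x∉R = contradiction (λ x∈R → contradiction x∈R x∉R) ¬[x∈R→x∈S]

module Component {m r} (_~_ : Rel (Fin m) r) (_~?_ : Decidable₂ _~_) where

  Adjacent : Rel (Fin m) r
  Adjacent x y = x ~ y ⊎ y ~ x

  Within : Subset m → Rel (Fin m) r
  Within S x y = x ∈ S × y ∈ S × x ~ y

  Joined : Subset m → Subset m → Pred (Fin m) r
  Joined S R y = y ∈ R ⊎ (y ∈ S × ∃ λ x → x ∈ R × Adjacent x y)

  joined? : ∀ S R → Decidable (Joined S R)
  joined? S R y = y ∈? R ⊎-dec (y ∈? S ×-dec any? λ x → x ∈? R ×-dec (x ~? y ⊎-dec y ~? x))

  expand : Subset m → Subset m → Subset m
  expand S R = subsetOf (joined? S R)

  closure : Subset m → Subset m → Subset m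
  closure S R = fold R (expand S) (suc m)

  module _ (S : Subset m) where

    ⊆-expand : ∀ {R} → R ⊆ expand S R
    ⊆-expand x∈R = ∈-subsetOf⁺ (joined? S _) (inj₁ x∈R)

    expand-≡-or-⊃ : ∀ R → expand S R ≡ R ⊎ R ⊂ expand S R
    expand-≡-or-⊃ R with ⊆-or-witness (expand S R) R
    ... | inj₁ expand⊆R = inj₁ (⊆-antisym expand⊆R ⊆-expand)
    ... | inj₂ new      = inj₂ (⊆-expand , new)

    -- each round either stabilises or adds an element, and at most m elements can be added
    fold-stable-or-large : ∀ {R} n → expand S (fold R (expand S) n) ≡ fold R (expand S) n ⊎ n ≤ ∣ fold R (expand S) n ∣
    fold-stable-or-large zero = inj₂ z≤n
    fold-stable-or-large {R} (suc n) with fold-stable-or-large {R} n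
    ... | inj₁ stable = inj₁ (cong (expand S) stable)
    ... | inj₂ n≤size with expand-≡-or-⊃ (fold R (expand S) n)
    ...   | inj₁ stable = inj₁ (cong (expand S) stable)
    ...   | inj₂ grows  = inj₂ (<-≤-trans (s≤s n≤size) (p⊂q⇒∣p∣<∣q∣ grows))

    closure-stable : ∀ R → expand S (closure S R) ≡ closure S R
    closure-stable R with fold-stable-or-large {R} (suc m)
    ... | inj₁ stable = stable
    ... | inj₂ large  = contradiction (∣p∣≤n (closure S R)) (<⇒≱ large)

    closure-closed : ∀ {R x y} → x ∈ closure S R → y ∈ S → Adjacent x y → y ∈ closure S R
    closure-closed {R} x∈ y∈S x~y = subst (_ ∈_) (closure-stable R) (∈-subsetOf⁺ (joined? S _) (inj₂ (y∈S , _ , x∈ , x~y)))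

    ⊆-closure : ∀ {R} → R ⊆ closure S R
    ⊆-closure {R} = go (suc m)
      where
      go : ∀ n → R ⊆ fold R (expand S) n
      go zero    = id
      go (suc n) = ⊆-expand ∘ go n

    module _ {R} (R⊆S : R ⊆ S) where

      fold-⊆ : ∀ n → fold R (expand S) n ⊆ S
      fold-⊆ zero    = R⊆S
      fold-⊆ (suc n) y∈ with ∈-subsetOf⁻ (joined? S _) y∈
      ... | inj₁ y∈fold      = fold-⊆ n y∈fold
      ... | inj₂ (y∈S , _)   = y∈S

      closure-⊆ : closure S R ⊆ S
      closure-⊆ = fold-⊆ (suc m)

      fold-path : ∀ n {y} → y ∈ fold R (expand S) n → ∃ λ x → x ∈ R × EqClosure (Within S) x y
      fold-path zero    y∈R = _ , y∈R , ε
      fold-path (suc n) {y} y∈ with ∈-subsetOf⁻ (joined? S _) y∈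
      ... | inj₁ y∈fold = fold-path n y∈fold
      ... | inj₂ (y∈S , x , x∈fold , adjacent) with fold-path n x∈fold
      ...   | x₀ , x₀∈R , path = x₀ , x₀∈R , path ◅◅ (edge adjacent ◅ ε)
        where
        edge : Adjacent x y → SymClosure (Within S) x y
        edge (inj₁ x~y) = fwd (fold-⊆ n x∈fold , y∈S , x~y)
        edge (inj₂ y~x) = bwd (y∈S , fold-⊆ n x∈fold , y~x)

      closure-path : ∀ {y} → y ∈ closure S R → ∃ λ x → x ∈ R × EqClosure (Within S) x y
      closure-path = fold-path (suc m)

  -- A canonical element of S, so that the component of S depends on S alone.
  rootOf : Subset m → Subset m
  rootOf S with nonempty? S
  ... | yes (x , _) = ⁅ x ⁆
  ... | no  _       = ∅

  module _ (S : Subset m) where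

    rootOf-⊆ : rootOf S ⊆ S
    rootOf-⊆ with nonempty? S
    ... | yes (x , x∈S) = λ r∈ → subst (_∈ S) (sym (x∈⁅y⁆⇒x≡y x r∈)) x∈S
    ... | no  _         = λ r∈∅ → contradiction r∈∅ ∉⊥

    rootOf-unique : ∀ {r r′} → r ∈ rootOf S → r′ ∈ rootOf S → r ≡ r′
    rootOf-unique r∈ r′∈ with nonempty? S
    ... | yes (x , _) = trans (x∈⁅y⁆⇒x≡y x r∈) (sym (x∈⁅y⁆⇒x≡y x r′∈))
    ... | no  _       = contradiction r∈ ∉⊥

    rootOf-nonempty : ∀ {x} → x ∈ S → ∃ (_∈ rootOf S)
    rootOf-nonempty x∈S with nonempty? S
    ... | yes (x , _) = x , x∈⁅x⁆ x
    ... | no  empty   = contradiction (_ , x∈S) empty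

    component : Subset m
    component = closure S (rootOf S)

    component-⊆ : component ⊆ S
    component-⊆ = closure-⊆ S rootOf-⊆

    component-closed : ∀ {x y} → x ∈ component → y ∈ S → Adjacent x y → y ∈ component
    component-closed = closure-closed S

    component-nonempty : ∀ {x} → x ∈ S → ∃ (_∈ component)
    component-nonempty x∈S = let (r , r∈) = rootOf-nonempty x∈S in r , ⊆-closure S r∈

    component-connected : ∀ {x y} → x ∈ component → y ∈ component → EqClosure (Within S) x y
    component-connected x∈ y∈ with closure-path S rootOf-⊆ x∈ | closure-path S rootOf-⊆ y∈
    ... | r , r∈ , r⇝x | r′ , r′∈ , r′⇝y rewrite rootOf-unique r∈ r′∈ =
      EqClosure.symmetric (Within S) r⇝x ◅◅ r′⇝y

module InducedSubposet {m} (P : FinPoset m) (height-2 : HasHeight2 P) where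

  open Component (_≺_ P) (_≺?_ P) public

  Connected : Subset m → Set
  Connected S = InducedConnected P (_∈ S)

  -- The only use of height 2: a comparable pair inside S is a cover of the induced subposet.
  within⇒cover : ∀ {S x y} → Within S x y → Cover P (_∈ S) x y
  within⇒cover {x = x} {y} (x∈S , y∈S , x≺y) = x∈S , y∈S , x≺y , λ (z , _ , x≺z , z≺y) → height-2 x z y x≺z z≺y

  reach-extend : ∀ {S x y z} → Reach P (_∈ S) x y → EqClosure (Within S) y z → Reach P (_∈ S) x z
  reach-extend x⇝y ε                = x⇝y
  reach-extend x⇝y (fwd edge ◅ path) = reach-extend (step x⇝y (inj₁ (within⇒cover edge))) path
  reach-extend x⇝y (bwd edge ◅ path) = reach-extend (step x⇝y (inj₂ (within⇒cover edge))) path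

  reach-closed : ∀ {S C x y} → (∀ {u v} → u ∈ C → v ∈ S → Adjacent u v → v ∈ C) →
    Reach P (_∈ S) x y → x ∈ C → y ∈ C
  reach-closed closed (here _)                               x∈C = x∈C
  reach-closed closed (step x⇝y (inj₁ (_ , z∈S , y≺z , _))) x∈C = closed (reach-closed closed x⇝y x∈C) z∈S (inj₁ y≺z)
  reach-closed closed (step x⇝y (inj₂ (z∈S , _ , z≺y , _))) x∈C = closed (reach-closed closed x⇝y x∈C) z∈S (inj₂ z≺y)

  connected⇒⊆component : ∀ S → Connected S → S ⊆ component S
  connected⇒⊆component S connected x∈S =
    let (r , r∈C) = component-nonempty S x∈S
    in reach-closed (component-closed S) (connected _ _ (component-⊆ S r∈C) x∈S) r∈C

  ⊆component⇒connected : ∀ S → S ⊆ component S → Connected S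
  ⊆component⇒connected S S⊆C x y x∈S y∈S =
    reach-extend (here x∈S) (component-connected S (S⊆C x∈S) (S⊆C y∈S))

  connected? : ∀ S → Dec (Connected S)
  connected? S with ⊆-or-witness S (component S)
  ... | inj₁ S⊆C               = yes (⊆component⇒connected S S⊆C)
  ... | inj₂ (z , z∈S , z∉C) = no (λ connected → z∉C (connected⇒⊆component S connected z∈S))

  disconnected-split : ∀ S → ¬ Connected S → ∃ (_∈ component S) × ∃ λ z → z ∈ S × z ∉ component S
  disconnected-split S disconnected with ⊆-or-witness S (component S)
  ... | inj₁ S⊆C           = contradiction (⊆component⇒connected S S⊆C) disconnected
  ... | inj₂ (z , z∈S , z∉C) = component-nonempty S z∈S , z , z∈S , z∉C

  reach-resp : ∀ {S S′ : Pred (Fin m) 0ℓ} → (∀ {x} → S x → S′ x) → (∀ {x} → S′ x → S x) →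
    ∀ {x y} → Reach P S x y → Reach P S′ x y
  reach-resp to from (here x∈)       = here (to x∈)
  reach-resp {S} {S′} to from (step x⇝y cover) = step (reach-resp to from x⇝y) (Sum.map cover-resp cover-resp cover)
    where
    cover-resp : ∀ {u v} → Cover P S u v → Cover P S′ u v
    cover-resp (u∈ , v∈ , u≺v , no-between) =
      to u∈ , to v∈ , u≺v , λ (z , z∈ , u≺z , z≺v) → no-between (z , from z∈ , u≺z , z≺v)

-- Blocks of labels and adapted linear extensions

LeastFailure : ∀ {p} → Pred ℕ p → ℕ → ℕ → Set p
LeastFailure Pr n j = j < n × ¬ Pr j × (∀ {k} → k < j → Pr k)

module _ {p} {Pr : Pred ℕ p} where

  least-failure : Decidable Pr → ∀ n → ¬ (∀ {j} → j < n → Pr j) → ∃ (LeastFailure Pr n)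
  least-failure Pr? zero    ¬all = contradiction (λ ()) ¬all
  least-failure Pr? (suc n) ¬all with allUpTo? Pr? n
  ... | yes all<n = n , ≤-refl , (λ Prn → ¬all (all≤n Prn)) , all<n
    where
    all≤n : Pr n → ∀ {j} → j < suc n → Pr j
    all≤n Prn (s≤s j≤n) with m≤n⇒m<n∨m≡n j≤n
    ... | inj₁ j<n  = all<n j<n
    ... | inj₂ refl = Prn
  ... | no ¬all<n = let (j , j<n , failure) = least-failure Pr? n ¬all<n in j , m<n⇒m<1+n j<n , failure

  least-failure-unique : ∀ {n j j′} → LeastFailure Pr n j → LeastFailure Pr n j′ → j ≡ j′
  least-failure-unique {j = j} {j′} (_ , ¬Prj , before) (_ , ¬Prj′ , before′) with <-cmp j j′
  ... | tri< j<j′ _ _ = contradiction (before′ j<j′) ¬Prj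
  ... | tri≈ _ j≡j′ _ = j≡j′
  ... | tri> _ _ j′<j = contradiction (before j′<j) ¬Prj′

  LeastFailure-resp : ∀ {Pr′ : Pred ℕ p} {n j} → (∀ {k} → Pr k → Pr′ k) → (∀ {k} → Pr′ k → Pr k) →
    LeastFailure Pr n j → LeastFailure Pr′ n j
  LeastFailure-resp to from (j<n , ¬Prj , before) = j<n , ¬Prj ∘ from , to ∘ before

module Quotient (q : ℕ) .⦃ _ : NonZero q ⦄ where

  [r+jq]%q≡r : ∀ {r} j → r < q → (r + j * q) % q ≡ r
  [r+jq]%q≡r {r} j r<q = trans ([m+kn]%n≡m%n r j q) (m<n⇒m%n≡m r<q)

  [r+jq]/q≡j : ∀ {r} j → r < q → (r + j * q) / q ≡ j
  [r+jq]/q≡j {r} j r<q = *-cancelʳ-≡ _ j q (+-cancelˡ-≡ r _ _ (begin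
    r + (r + j * q) / q * q                  ≡⟨ cong (_+ (r + j * q) / q * q) ([r+jq]%q≡r j r<q) ⟨
    (r + j * q) % q + (r + j * q) / q * q    ≡⟨ m≡m%n+[m/n]*n (r + j * q) q ⟨
    r + j * q                                ∎))
    where open ≡-Reasoning

  divMod-injective : ∀ {t t′} → t / q ≡ t′ / q → t % q ≡ t′ % q → t ≡ t′
  divMod-injective {t} {t′} /≡ %≡ = begin
    t                    ≡⟨ m≡m%n+[m/n]*n t q ⟩
    t % q + t / q * q    ≡⟨ cong₂ (λ r j → r + j * q) %≡ /≡ ⟩
    t′ % q + t′ / q * q  ≡⟨ m≡m%n+[m/n]*n t′ q ⟨
    t′                   ∎
    where open ≡-Reasoning

  bounds⇒/≡ : ∀ {t} j → j * q ≤ t → t < suc j * q → t / q ≡ j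
  bounds⇒/≡ {t} j jq≤t t<[1+j]q = begin
    t / q                  ≡⟨ cong (_/ q) (m∸n+n≡m jq≤t) ⟨
    (t ∸ j * q + j * q) / q ≡⟨ [r+jq]/q≡j j (m<n+o⇒m∸n<o t (j * q) (subst (t <_) (+-comm q (j * q)) t<[1+j]q)) ⟩
    j                      ∎
    where open ≡-Reasoning

  /≡⇒bounds : ∀ {t} j → t / q ≡ j → j * q ≤ t × t < suc j * q
  /≡⇒bounds {t} j refl =
    subst (j * q ≤_) (sym (m≡m%n+[m/n]*n t q)) (m≤n+m (j * q) (t % q)) ,
    subst (_< q + j * q) (sym (m≡m%n+[m/n]*n t q)) (+-monoˡ-< (j * q) (m%n<n t q))

  same-block-%-< : ∀ {t t′} → t / q ≡ t′ / q → t < t′ → t % q < t′ % q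
  same-block-%-< {t} {t′} same-block t<t′ = +-cancelʳ-< (t / q * q) (t % q) (t′ % q)
    (subst₂ _<_ (m≡m%n+[m/n]*n t q) (trans (m≡m%n+[m/n]*n t′ q) (cong (λ i → t′ % q + i * q) (sym same-block))) t<t′)

  /-<⇒< : ∀ {t t′} → t / q < t′ / q → t < t′
  /-<⇒< /< = ≰⇒> λ t′≤t → <⇒≱ /< (/-monoˡ-≤ q t′≤t)

  module BlockPermutation {m} (j : ℕ) (fits : suc j * q ≤ m) (ρ : ℕ → ℕ) (ρ-< : ∀ {p} → p < q → ρ p < q) where

    private
      in-range : ∀ {p} → p < q → p + j * q < m
      in-range p<q = <-≤-trans (+-monoˡ-< (j * q) p<q) fits

    permute : Fin m → Fin m
    permute t with toℕ t / q ≟ j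
    ... | yes _ = fromℕ< (in-range (ρ-< (m%n<n (toℕ t) q)))
    ... | no  _ = t

    toℕ-permute-in : ∀ {t} → toℕ t / q ≡ j → toℕ (permute t) ≡ ρ (toℕ t % q) + j * q
    toℕ-permute-in {t} t/q≡j with toℕ t / q ≟ j
    ... | yes _     = toℕ-fromℕ< _
    ... | no  t/q≢j = contradiction t/q≡j t/q≢j

    permute-out : ∀ {t} → toℕ t / q ≢ j → permute t ≡ t
    permute-out {t} t/q≢j with toℕ t / q ≟ j
    ... | yes t/q≡j = contradiction t/q≡j t/q≢j
    ... | no  _     = refl

    permute-% : ∀ {t} → toℕ t / q ≡ j → toℕ (permute t) % q ≡ ρ (toℕ t % q)
    permute-% {t} t/q≡j = trans (cong (_% q) (toℕ-permute-in t/q≡j)) ([r+jq]%q≡r j (ρ-< (m%n<n (toℕ t) q)))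

    permute-/ : ∀ t → toℕ (permute t) / q ≡ toℕ t / q
    permute-/ t = by-block (toℕ t / q ≟ j)
      where
      by-block : Dec (toℕ t / q ≡ j) → toℕ (permute t) / q ≡ toℕ t / q
      by-block (no t/q≢j)  = cong (λ u → toℕ u / q) (permute-out t/q≢j)
      by-block (yes t/q≡j) = trans (cong (_/ q) (toℕ-permute-in t/q≡j))
                                   (trans ([r+jq]/q≡j j (ρ-< (m%n<n (toℕ t) q))) (sym t/q≡j))

    permute-preserves-block : ∀ {t t′} → permute t ≡ permute t′ → toℕ t / q ≡ toℕ t′ / q
    permute-preserves-block {t} {t′} eq = trans (sym (permute-/ t)) (trans (cong (λ u → toℕ u / q) eq) (permute-/ t′))

    permute-injective : (∀ {p p′} → p < q → p′ < q → ρ p ≡ ρ p′ → p ≡ p′) →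
      ∀ {t t′} → permute t ≡ permute t′ → t ≡ t′
    permute-injective ρ-injective {t} {t′} eq = by-block (toℕ t / q ≟ j)
      where
      open ≡-Reasoning
      same-block : toℕ t / q ≡ toℕ t′ / q
      same-block = permute-preserves-block eq
      by-block : Dec (toℕ t / q ≡ j) → t ≡ t′
      by-block (no t/q≢j) = begin
        t           ≡⟨ permute-out t/q≢j ⟨
        permute t   ≡⟨ eq ⟩
        permute t′  ≡⟨ permute-out (t/q≢j ∘ trans same-block) ⟩
        t′          ∎
      by-block (yes t/q≡j) = toℕ-injective (divMod-injective same-block
        (ρ-injective (m%n<n (toℕ t) q) (m%n<n (toℕ t′) q) (begin
          ρ (toℕ t % q)         ≡⟨ permute-% t/q≡j ⟨
          toℕ (permute t) % q   ≡⟨ cong (λ u → toℕ u % q) eq ⟩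
          toℕ (permute t′) % q  ≡⟨ permute-% (trans (sym same-block) t/q≡j) ⟩
          ρ (toℕ t′ % q)        ∎)))

    permute-surjective : (∀ {r} → r < q → ∃ λ p → p < q × ρ p ≡ r) → ∀ u → ∃ λ t → permute t ≡ u
    permute-surjective ρ-surjective u = by-block (toℕ u / q ≟ j)
      where
      by-block : Dec (toℕ u / q ≡ j) → ∃ λ t → permute t ≡ u
      by-block (no u/q≢j)  = u , permute-out u/q≢j
      by-block (yes u/q≡j) with ρ-surjective (m%n<n (toℕ u) q)
      ... | p , p<q , ρp≡u%q = t , toℕ-injective (begin
        toℕ (permute t)           ≡⟨ toℕ-permute-in t/q≡j ⟩
        ρ (toℕ t % q) + j * q     ≡⟨ cong (λ r → ρ r + j * q) t%q≡p ⟩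
        ρ p + j * q               ≡⟨ cong₂ (λ r i → r + i * q) ρp≡u%q (sym u/q≡j) ⟩
        toℕ u % q + toℕ u / q * q ≡⟨ m≡m%n+[m/n]*n (toℕ u) q ⟨
        toℕ u                     ∎)
        where
        open ≡-Reasoning
        t : Fin m
        t = fromℕ< (in-range p<q)
        t%q≡p : toℕ t % q ≡ p
        t%q≡p = trans (cong (_% q) (toℕ-fromℕ< (in-range p<q))) ([r+jq]%q≡r j p<q)
        t/q≡j : toℕ t / q ≡ j
        t/q≡j = trans (cong (_/ q) (toℕ-fromℕ< (in-range p<q))) ([r+jq]/q≡j j p<q)

    permute-< : ∀ {t t′} → toℕ t < toℕ t′ → (toℕ t / q ≡ j → toℕ t′ / q ≡ j → ρ (toℕ t % q) < ρ (toℕ t′ % q)) →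
      toℕ (permute t) < toℕ (permute t′)
    permute-< {t} {t′} t<t′ ρ-ordered with toℕ t / q ≟ toℕ t′ / q
    ... | no different-blocks = /-<⇒< (subst₂ _<_ (sym (permute-/ t)) (sym (permute-/ t′))
                                  (≤∧≢⇒< (/-monoˡ-≤ q (<⇒≤ t<t′)) different-blocks))
    ... | yes same-block = by-block (toℕ t / q ≟ j)
      where
      by-block : Dec (toℕ t / q ≡ j) → toℕ (permute t) < toℕ (permute t′)
      by-block (no t/q≢j)  = subst₂ (λ u u′ → toℕ u < toℕ u′) (sym (permute-out t/q≢j))
                               (sym (permute-out (t/q≢j ∘ trans same-block))) t<t′
      by-block (yes t/q≡j) = subst₂ _<_ (sym (toℕ-permute-in t/q≡j)) (sym (toℕ-permute-in t′/q≡j))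
                               (+-monoˡ-< (j * q) (ρ-ordered t/q≡j t′/q≡j))
        where t′/q≡j = trans (sym same-block) t/q≡j

  permute-cong : ∀ {m j} {fits₁ fits₂ : suc j * q ≤ m} {ρ₁ ρ₂ : ℕ → ℕ}
    {ρ₁-< : ∀ {p} → p < q → ρ₁ p < q} {ρ₂-< : ∀ {p} → p < q → ρ₂ p < q} → (∀ p → ρ₁ p ≡ ρ₂ p) →
    ∀ t → BlockPermutation.permute j fits₁ ρ₁ ρ₁-< t ≡ BlockPermutation.permute j fits₂ ρ₂ ρ₂-< t
  permute-cong {j = j} {fits₁} {fits₂} {ρ₁} {ρ₂} {ρ₁-<} {ρ₂-<} ρ₁≗ρ₂ t = by-block (toℕ t / q ≟ j)
    where
    module B₁ = BlockPermutation j fits₁ ρ₁ ρ₁-<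
    module B₂ = BlockPermutation j fits₂ ρ₂ ρ₂-<
    by-block : Dec (toℕ t / q ≡ j) → B₁.permute t ≡ B₂.permute t
    by-block (no t/q≢j)  = trans (B₁.permute-out t/q≢j) (sym (B₂.permute-out t/q≢j))
    by-block (yes t/q≡j) = toℕ-injective (trans (B₁.toℕ-permute-in t/q≡j)
                             (trans (cong (_+ j * q) (ρ₁≗ρ₂ (toℕ t % q))) (sym (B₂.toℕ-permute-in t/q≡j))))

module AdaptedLinearExtensions (q : ℕ) .⦃ _ : NonZero q ⦄ {m} (P : FinPoset m) (height-2 : HasHeight2 P) where

  open Quotient q
  open InducedSubposet P height-2

  -- Labellings are vectors, as in the definition of e P, so that σ acts on the enumerated list.
  Labelling : Set
  Labelling = Vec (Fin m) m

  label : Labelling → Fin m → ℕ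
  label v x = toℕ (lookup v x)

  inBlock? : ∀ v j → Decidable (λ x → label v x / q ≡ j)
  inBlock? v j x = label v x / q ≟ j

  -- Block j consists of the labels jq, …, jq+q−1; it is Block (lookup v) q (suc j).
  blockSet : Labelling → ℕ → Subset m
  blockSet v j = subsetOf (inBlock? v j)

  Adapted : Labelling → Set
  Adapted v = ∀ {j} → j < m / q → Connected (blockSet v j)

  adapted? : ∀ v → Dec (Adapted v)
  adapted? v = allUpTo? (connected? ∘ blockSet v) (m / q)

  block-fits : ∀ {j} → j < m / q → suc j * q ≤ m
  block-fits j<m/q = ≤-trans (*-monoˡ-≤ q j<m/q) (m/n*n≤m m q)

  labelled? : ∀ v A p → Decidable (λ x → x ∈ A × label v x % q ≡ p)
  labelled? v A p x = x ∈? A ×-dec (label v x % q ≟ p)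

  -- For A inside one block: whether the element at position p of that block lies in A.
  word : Labelling → Subset m → ℕ → Bool
  word v A p = does (any? (labelled? v A p))

  word-beyond : ∀ {v A p} → q ≤ p → word v A p ≡ false
  word-beyond {v} {A} {p} q≤p =
    dec-false (any? (labelled? v A p)) λ (x , _ , r≡p) → <⇒≱ (m%n<n _ q) (subst (q ≤_) (sym r≡p) q≤p)

  word-at : ∀ {v A j x} → (∀ x y → lookup v x ≡ lookup v y → x ≡ y) → A ⊆ blockSet v j → x ∈ blockSet v j →
    word v A (label v x % q) ≡ does (x ∈? A)
  word-at {v} {A} {j} {x} injective A⊆B x∈B with x ∈? A
  ... | yes x∈A = dec-true (any? (labelled? v A _)) (x , x∈A , refl)
  ... | no  x∉A = dec-false (any? (labelled? v A _))
                    λ (y , y∈A , same-rem) → x∉A (subst (_∈ A) (same-element y∈A same-rem) y∈A)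
    where
    same-element : ∀ {y} → y ∈ A → label v y % q ≡ label v x % q → y ≡ x
    same-element y∈A same-rem = injective _ x (toℕ-injective (divMod-injective
      (trans (∈-subsetOf⁻ (inBlock? v j) (A⊆B y∈A)) (sym (∈-subsetOf⁻ (inBlock? v j) x∈B))) same-rem))

  module AtBlock (v : Labelling) (j : ℕ) (j<m/q : j < m / q) where

    S : Subset m
    S = blockSet v j

    A : Subset m
    A = component S

    w : ℕ → Bool
    w = word v A

    open Rotation q w using (rotate; rotate-<; rotate-monotone; rotate-injective; rotate-surjective; rotate-isLeftRotation) public
    open BlockPermutation j (block-fits j<m/q) rotate rotate-< public

    rotated : Labelling
    rotated = tabulate (permute ∘ lookup v)

    lookup-rotated : ∀ x → lookup rotated x ≡ permute (lookup v x)
    lookup-rotated = lookup∘tabulate (permute ∘ lookup v)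

    blockSet-rotated : ∀ k → blockSet rotated k ≡ blockSet v k
    blockSet-rotated k = tabulate-cong λ x →
      cong (λ t → does (t ≟ k)) (trans (cong (λ u → toℕ u / q) (lookup-rotated x)) (permute-/ (lookup v x)))

    module _ (linear : IsLinearExtension P (lookup v)) where

      private
        injective : ∀ x y → lookup v x ≡ lookup v y → x ≡ y
        injective = proj₁ (proj₁ linear)
        surjective : ∀ t → ∃ λ x → lookup v x ≡ t
        surjective = proj₂ (proj₁ linear)
        monotone : ∀ x y → _≺_ P x y → label v x < label v y
        monotone = proj₂ linear

      labelled : ∀ {t} → t < m → ∃ λ x → label v x ≡ t
      labelled t<m = let (x , vx≡t) = surjective (fromℕ< t<m) in x , trans (cong toℕ vx≡t) (toℕ-fromℕ< t<m)

      same-colour : ∀ {x y} → x ∈ S → y ∈ S → _≺_ P x y → does (x ∈? A) ≡ does (y ∈? A)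
      same-colour {x} {y} x∈S y∈S x≺y with x ∈? A | y ∈? A
      ... | yes _   | yes _   = refl
      ... | no  _   | no  _   = refl
      ... | yes x∈A | no  y∉A = contradiction (component-closed S x∈A y∈S (inj₁ x≺y)) y∉A
      ... | no  x∉A | yes y∈A = contradiction (component-closed S y∈A x∈S (inj₂ x≺y)) x∉A

      rotated-linear : IsLinearExtension P (lookup rotated)
      rotated-linear = (rotated-injective , rotated-surjective) , rotated-monotone
        where
        rotated-injective : ∀ x y → lookup rotated x ≡ lookup rotated y → x ≡ y
        rotated-injective x y eq = injective x y (permute-injective rotate-injective
          (trans (sym (lookup-rotated x)) (trans eq (lookup-rotated y))))
        rotated-surjective : ∀ u → ∃ λ x → lookup rotated x ≡ u
        rotated-surjective u =
          let (t , permute-t≡u) = permute-surjective rotate-surjective u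
              (x , vx≡t) = surjective t
          in x , trans (lookup-rotated x) (trans (cong permute vx≡t) permute-t≡u)
        rotated-monotone : ∀ x y → _≺_ P x y → toℕ (lookup rotated x) < toℕ (lookup rotated y)
        rotated-monotone x y x≺y = subst₂ (λ u u′ → toℕ u < toℕ u′) (sym (lookup-rotated x)) (sym (lookup-rotated y))
          (permute-< (monotone x y x≺y) λ x/q≡j y/q≡j →
            let x∈S = ∈-subsetOf⁺ (inBlock? v j) x/q≡j
                y∈S = ∈-subsetOf⁺ (inBlock? v j) y/q≡j
            in rotate-monotone (same-block-%-< (trans x/q≡j (sym y/q≡j)) (monotone x y x≺y)) (m%n<n (label v y) q)
                 (trans (word-at {v} injective (component-⊆ S) x∈S)
                   (trans (same-colour x∈S y∈S x≺y) (sym (word-at {v} injective (component-⊆ S) y∈S)))))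

      rotated-word : IsLeftRotation q w (word rotated A)
      rotated-word = rotate-isLeftRotation (word rotated A) relabel
        where
        relabel : ∀ {p} → p < q → word rotated A (rotate p) ≡ w p
        relabel {p} p<q = begin
          word rotated A (rotate p)             ≡⟨ cong (word rotated A) rotated-remainder ⟨
          word rotated A (label rotated x % q)  ≡⟨ word-at {rotated} (proj₁ (proj₁ rotated-linear))
                                                     (subst (A ⊆_) (sym (blockSet-rotated j)) (component-⊆ S))
                                                     (subst (x ∈_) (sym (blockSet-rotated j)) x∈S) ⟩
          does (x ∈? A)                         ≡⟨ word-at {v} injective (component-⊆ S) x∈S ⟨
          w (label v x % q)                     ≡⟨ cong w x-remainder ⟩
          w p                                   ∎
          where
          open ≡-Reasoning
          element : ∃ λ x → label v x ≡ p + j * q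
          element = labelled (<-≤-trans (+-monoˡ-< (j * q) p<q) (block-fits j<m/q))
          x : Fin m
          x = proj₁ element
          x/q≡j : label v x / q ≡ j
          x/q≡j = trans (cong (_/ q) (proj₂ element)) ([r+jq]/q≡j j p<q)
          x-remainder : label v x % q ≡ p
          x-remainder = trans (cong (_% q) (proj₂ element)) ([r+jq]%q≡r j p<q)
          x∈S : x ∈ S
          x∈S = ∈-subsetOf⁺ (inBlock? v j) x/q≡j
          rotated-remainder : label rotated x % q ≡ rotate p
          rotated-remainder = trans (cong (λ u → toℕ u % q) (lookup-rotated x)) (trans (permute-% x/q≡j) (cong rotate x-remainder))

      module _ (disconnected : ¬ Connected S) where

        0<ones : 0 < ones q w
        0<ones with disconnected-split S disconnected
        ... | (a , a∈A) , _ = ones-pos {w = w} (m%n<n (label v a) q)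
          (trans (word-at {v} injective (component-⊆ S) (component-⊆ S a∈A)) (dec-true (a ∈? A) a∈A))

        ones<q : ones q w < q
        ones<q with disconnected-split S disconnected
        ... | _ , z , z∈S , z∉A = ones-< {w = w} (m%n<n (label v z) q)
          (trans (word-at {v} injective (component-⊆ S) z∈S) (dec-false (z ∈? A) z∉A))

  FirstDisconnected : Labelling → ℕ → Set
  FirstDisconnected v = LeastFailure (Connected ∘ blockSet v) (m / q)

  first-disconnected : ∀ v → ¬ Adapted v → ∃ (FirstDisconnected v)
  first-disconnected v = least-failure {Pr = Connected ∘ blockSet v} (connected? ∘ blockSet v) (m / q)

  Classification : Labelling → Set
  Classification v = Adapted v ⊎ ∃ (FirstDisconnected v)

  classify : ∀ v → Classification v
  classify v with adapted? v
  ... | yes adapted = inj₁ adapted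
  ... | no ¬adapted = inj₂ (first-disconnected v ¬adapted)

  rotateAt : ∀ v → Classification v → Labelling
  rotateAt v (inj₁ _)                = v
  rotateAt v (inj₂ (j , j<m/q , _)) = AtBlock.rotated v j j<m/q

  statisticAt : ∀ v → Classification v → ℕ
  statisticAt v (inj₁ _)       = 0
  statisticAt v (inj₂ (j , _)) = statistic q (word v (component (blockSet v j)))

  σ : Labelling → Labelling
  σ v = rotateAt v (classify v)

  h : Labelling → ℕ
  h v = statisticAt v (classify v)

  module _ {v} (¬adapted : ¬ Adapted v) {j} (first : FirstDisconnected v j) where

    rotateAt-first : ∀ c → rotateAt v c ≡ AtBlock.rotated v j (proj₁ first)
    rotateAt-first (inj₁ adapted)     = ⊥-elim (¬adapted adapted)
    rotateAt-first (inj₂ (_ , first′)) with least-failure-unique first′ first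
    ... | refl = cong (AtBlock.rotated v j) (≤-irrelevant (proj₁ first′) (proj₁ first))

    statisticAt-first : ∀ c → statisticAt v c ≡ statistic q (word v (component (blockSet v j)))
    statisticAt-first (inj₁ adapted)     = ⊥-elim (¬adapted adapted)
    statisticAt-first (inj₂ (_ , first′)) = cong (λ i → statistic q (word v (component (blockSet v i))))
                                             (least-failure-unique first′ first)

  module NonAdapted {v} (linear : IsLinearExtension P (lookup v)) (¬adapted : ¬ Adapted v)
                    {j} (first : FirstDisconnected v j) where

    open AtBlock v j (proj₁ first) public

    σ≡rotated : σ v ≡ rotated
    σ≡rotated = rotateAt-first {v} ¬adapted {j} first (classify v)

    σ-blockSet : ∀ k → blockSet (σ v) k ≡ blockSet v k
    σ-blockSet k = trans (cong (λ u → blockSet u k) σ≡rotated) (blockSet-rotated k)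

    σ-first : FirstDisconnected (σ v) j
    σ-first = LeastFailure-resp (λ {k} → subst Connected (sym (σ-blockSet k))) (λ {k} → subst Connected (σ-blockSet k)) first

    σ-¬adapted : ¬ Adapted (σ v)
    σ-¬adapted adapted = ¬adapted λ {k} k<m/q → subst Connected (σ-blockSet k) (adapted k<m/q)

    σ-linear : IsLinearExtension P (lookup (σ v))
    σ-linear = subst (IsLinearExtension P ∘ lookup) (sym σ≡rotated) (rotated-linear linear)

    σ-word : IsLeftRotation q w (word (σ v) A)
    σ-word = subst (λ u → IsLeftRotation q w (word u A)) (sym σ≡rotated) (rotated-word linear)

    h-σ : Prime q → suc (h (σ v)) % q ≡ h v % q
    h-σ q-prime = begin
      suc (h (σ v)) % q
        ≡⟨ cong (λ n → suc n % q) (statisticAt-first {σ v} σ-¬adapted {j} σ-first (classify (σ v))) ⟩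
      suc (statistic q (word (σ v) (component (blockSet (σ v) j)))) % q
        ≡⟨ cong (λ B → suc (statistic q (word (σ v) (component B))) % q) (σ-blockSet j) ⟩
      suc (statistic q (word (σ v) A)) % q
        ≡⟨ statistic-rotation q {w} {word (σ v) A} q-prime σ-word (0<ones linear disconnected) (ones<q linear disconnected) ⟩
      statistic q w % q
        ≡⟨ cong (_% q) (statisticAt-first {v} ¬adapted {j} first (classify v)) ⟨
      h v % q
        ∎
      where
      open ≡-Reasoning
      disconnected : ¬ Connected S
      disconnected = proj₁ (proj₂ first)

  module _ {v₁ v₂} (linear₁ : IsLinearExtension P (lookup v₁)) (¬adapted₁ : ¬ Adapted v₁)
                   (linear₂ : IsLinearExtension P (lookup v₂)) (¬adapted₂ : ¬ Adapted v₂) where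

    -- σ v has the blocks, hence the first disconnected block and component, of v, and its word
    -- is the rotation of that of v; so both words agree and the same permutation is undone.
    σ-injective-at : ∀ {j} → FirstDisconnected v₁ j → FirstDisconnected v₂ j → σ v₁ ≡ σ v₂ → v₁ ≡ v₂
    σ-injective-at {j} first₁ first₂ σ≡σ =
      trans (sym (tabulate∘lookup v₁)) (trans (tabulate-cong same-labels) (tabulate∘lookup v₂))
      where
      module N₁ = NonAdapted {v₁} linear₁ ¬adapted₁ {j} first₁
      module N₂ = NonAdapted {v₂} linear₂ ¬adapted₂ {j} first₂
      open ≡-Reasoning

      S₁≡S₂ : N₁.S ≡ N₂.S
      S₁≡S₂ = trans (sym (N₁.σ-blockSet j)) (trans (cong (λ u → blockSet u j) σ≡σ) (N₂.σ-blockSet j))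

      rotation₂ : IsLeftRotation q N₂.w (word (σ v₁) N₁.A)
      rotation₂ = subst₂ (λ u S → IsLeftRotation q N₂.w (word u (component S))) (sym σ≡σ) (sym S₁≡S₂) N₂.σ-word

      same-word : ∀ t → N₁.w t ≡ N₂.w t
      same-word t with t <? q
      ... | yes t<q = left-rotation-unique {w₁ = N₁.w} {N₂.w} N₁.σ-word rotation₂ t<q
      ... | no  t≮q = trans (word-beyond {v₁} (≮⇒≥ t≮q)) (sym (word-beyond {v₂} (≮⇒≥ t≮q)))

      same-labels : ∀ x → lookup v₁ x ≡ lookup v₂ x
      same-labels x = N₂.permute-injective N₂.rotate-injective (begin
        N₂.permute (lookup v₁ x)  ≡⟨ permute-cong (rotate-cong {q} {N₁.w} {N₂.w} same-word) (lookup v₁ x) ⟨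
        N₁.permute (lookup v₁ x)  ≡⟨ N₁.lookup-rotated x ⟨
        lookup N₁.rotated x       ≡⟨ cong (λ u → lookup u x) (trans (sym N₁.σ≡rotated) (trans σ≡σ N₂.σ≡rotated)) ⟩
        lookup N₂.rotated x       ≡⟨ N₂.lookup-rotated x ⟩
        N₂.permute (lookup v₂ x)  ∎)

    σ-injective : σ v₁ ≡ σ v₂ → v₁ ≡ v₂
    σ-injective σ≡σ = σ-injective-at first₁ (subst (FirstDisconnected v₂) (sym j₁≡j₂) first₂) σ≡σ
      where
      j₁ j₂ : ℕ
      j₁ = proj₁ (first-disconnected v₁ ¬adapted₁)
      j₂ = proj₁ (first-disconnected v₂ ¬adapted₂)
      first₁ : FirstDisconnected v₁ j₁
      first₁ = proj₂ (first-disconnected v₁ ¬adapted₁)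
      first₂ : FirstDisconnected v₂ j₂
      first₂ = proj₂ (first-disconnected v₂ ¬adapted₂)
      j₁≡j₂ : j₁ ≡ j₂
      j₁≡j₂ = least-failure-unique (NonAdapted.σ-first {v₁} linear₁ ¬adapted₁ {j₁} first₁)
        (subst (λ u → FirstDisconnected u j₂) (sym σ≡σ) (NonAdapted.σ-first {v₂} linear₂ ¬adapted₂ {j₂} first₂))

  e-divisible : Prime q → (∀ v → IsLinearExtension P (lookup v) → ¬ Adapted v) → q ∣ e P
  e-divisible q-prime ¬adapted = ResidueCounting.q∣length-filter q (isLinearExtension? P ∘ lookup) h
    (allVecs-unique m m) (allVecs-complete m m) σ
    (λ {v} linear → NonAdapted.σ-linear linear (¬adapted v linear) (first v linear))
    (λ {v₁} {v₂} linear₁ linear₂ →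
       σ-injective {v₁} {v₂} linear₁ (¬adapted v₁ linear₁) linear₂ (¬adapted v₂ linear₂))
    (λ {v} linear → NonAdapted.h-σ linear (¬adapted v linear) (first v linear) q-prime)
    where
    first : ∀ v (linear : IsLinearExtension P (lookup v)) → FirstDisconnected v _
    first v linear = proj₂ (first-disconnected v (¬adapted v linear))

  adapted-extension : Prime q → ¬ (q ∣ e P) → ∃ λ v → IsLinearExtension P (lookup v) × Adapted v
  adapted-extension q-prime q∤e with Any.any? (λ v → isLinearExtension? P (lookup v) ×-dec adapted? v) (allVecs m m)
  ... | yes found = satisfied found
  ... | no  none  = contradiction (e-divisible q-prime λ v linear adapted →
                      none (Any.map (λ { refl → linear , λ {j} → adapted {j} }) (allVecs-complete m m v))) q∤e

  Adapted⇒Block-connected : ∀ {v} → Adapted v → (i : ℕ) → 1 ≤ i → i ≤ m / q → InducedConnected P (Block (lookup v) q i)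
  Adapted⇒Block-connected {v} adapted (suc j) _ j<m/q x y x∈ y∈ =
    reach-resp (/≡⇒bounds j ∘ ∈-subsetOf⁻ (inBlock? v j)) (∈-subsetOf⁺ (inBlock? v j) ∘ uncurry (bounds⇒/≡ j))
      (adapted j<m/q x y (∈-subsetOf⁺ (inBlock? v j) (uncurry (bounds⇒/≡ j) x∈))
                         (∈-subsetOf⁺ (inBlock? v j) (uncurry (bounds⇒/≡ j) y∈)))

mainTheorem7 : (q : ℕ) → .⦃ _ : NonZero q ⦄ → Prime q → (m : ℕ) → (P : FinPoset m) → HasHeight2 P →
    ¬ (q ∣ e P) →
    Σ (Fin m → Fin m) (λ ℓ → IsLinearExtension P ℓ ×
      ((i : ℕ) → 1 ≤ i → i ≤ m / q → InducedConnected P (Block ℓ q i)))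
mainTheorem7 q q-prime m P height-2 q∤e =
  let (v , linear , adapted) = adapted-extension q-prime q∤e
  in lookup v , linear , Adapted⇒Block-connected {v} adapted
  where open AdaptedLinearExtensions q P height-2
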